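{- Let $A$ be a finite nonempty set of agents and $\mathrm{AP}$ a set of atomic propositions. The functors $\kappa$ and $\sigma$ induce an equivalence of categories between the category of simplicial models over $A$ and $\mathrm{AP}$ and the category of proper partial epistemic models over $A$ and $\mathrm{AP}$; and likewise between the corresponding categories of pointed simplicial models and pointed proper partial epistemic models.
   Context: $\mathrm{AP}=\bigcup_{a\in A}\mathrm{AP}_a$ is a disjoint union; for $U\subseteq A$, $\mathrm{AP}_U=\bigcup_{a\in U}\mathrm{AP}_a$. A chromatic simplicial complex $\langle V,S,\chi\rangle$: $S$ a family of nonempty subsets of $V$ containing singletons, closed under nonempty subsets, $\chi:V\to A$ injective on each simplex; $\mathcal{F}(\mathcal{C})$ its facets. A simplicial model $\langle V,S,\chi,\ell\rangle$ adds $\ell:\mathcal{F}(\mathcal{C})\to\mathcal{P}(\mathrm{AP})$; a morphism $f:\mathcal{C}\to\mathcal{D}$ is a chromatic simplicial map (vertex map preserving simplexes and colours) such that for all $X\in\mathcal{F}(\mathcal{C})$, $Y\in\mathcal{F}(\mathcal{D})$ with $f(X)\subseteq Y$, $\ell'(Y)\cap\mathrm{AP}_{\chi(X)}=\ell(X)\cap\mathrm{AP}_{\chi(X)}$. Pointed: pairs $(\mathcal{C},X)$, $X$ a facet; morphisms $f:(\mathcal{C},X)\to(\mathcal{D},Y)$ also satisfy $f(X)\subseteq Y$. A partial epistemic frame $\langle W,\sim\rangle$ has each $\sim_a$ symmetric and transitive; $\mathrm{live}(w)=\{a\mid w\sim_a w\}$; proper means for all $w,w'$ there is $a$ with $w\sim_a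 w$ and ($w\neq w'\Rightarrow w\not\sim_a w'$); $\mathrm{sat}_U(w)=\{w'\mid w\sim_a w'\ \forall a\in U\}$. Frame morphisms $h:W\to\mathcal{P}(W')$: $u\sim_a v\Rightarrow u'\sim'_a v'$ for all $u'\in h(u),v'\in h(v)$, and each $h(u)=\mathrm{sat}_{\mathrm{live}(u)}(u')$ for some $u'\in h(u)$; composition $(g\circ f)(u)=\mathrm{sat}_{\mathrm{live}(u)}(w)$ for any $v\in f(u)$, $w\in g(v)$. A partial epistemic model $\langle W,\sim,L\rangle$ adds $L:W\to\mathcal{P}(\mathrm{AP})$; a morphism is a frame morphism $h$ with $L'(w')\cap\mathrm{AP}_{\mathrm{live}(w)}=L(w)\cap\mathrm{AP}_{\mathrm{live}(w)}$ for all $w$ and $w'\in h(w)$; it is proper if its frame is. Pointed: pairs $(M,w)$; morphisms $h:(M,w)\to(M',w')$ satisfy $w'\in h(w)$. Functors: $\kappa(\mathcal{C})$ has worlds $\mathcal{F}(\mathcal{C})$, $X\sim_a Y$ iff $a\in\chi(X\cap Y)$, $L(X)=\ell(X)$; $\kappa(f)(X)=\{Z\in\mathcal{F}(\mathcal{D})\mid f(X)\subseteq Z\}$; $\kappa(\mathcal{C},X)=(\kappa(\mathcal{C}),X)$. $\sigma(M)$ has vertices $v^w_a=(a,[w]_a)$ ($w\in W$, $a\in\mathrm{live}(w)$, $[w]_a$ the $\sim_a$-class), simplexes all nonempty subsets of $X_w=\{v^w_a\mid a\in\mathrm{live}(w)\}$, $\chi(v^w_a)=a$, $\ell(X_w)=L(w)$;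 $\sigma(f)(v^w_a)=v^{w'}_a$ for any $w'\in f(w)$; $\sigma(M,w)=(\sigma(M),X_w)$. -}

module Defs where

open import Data.Bool using (Bool; true)
open import Data.Product using (Σ; _×_; _,_; proj₁; proj₂)
open import Relation.Nullary using (¬_)
open import Relation.Binary.PropositionalEquality using (_≡_; refl)
open import Relation.Binary.Structures using (IsEquivalence)

Pred : Set → Set₁
Pred X = X → Set

infix 4 _⊆_ _≐_ _⟺_

_⟺_ : Set → Set → Set
P ⟺ Q = (P → Q) × (Q → P)

_⊆_ : {X : Set} → Pred X → Pred X → Set
P ⊆ Q = ∀ x → P x → Q x

_≐_ : {X : Set} → Pred X → Pred X → Set
P ≐ Q = (P ⊆ Q) × (Q ⊆ P)

-- Everything is relative to a set of agents A and a set AP of atomic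
-- propositions, given as a disjoint union  AP = ⋃_a AP_a  via  own : AP → A
-- (p ∈ AP_a  iff  own p ≡ a).

module Setup (A : Set) (AP : Set) (own : AP → A) where

  APof : Pred A → Pred AP
  APof U p = U (own p)

  AgreeOn : Pred A → Pred AP → Pred AP → Set
  AgreeOn U L L' = ∀ p → APof U p → (L p ⟺ L' p)

  -- The vertex set is a setoid (V, _≈_) (needed since σ builds vertices
  -- from equivalence classes).  The family S of simplexes is given by an
  -- index set I and the subsets  mem i ⊆ V  (i ∈ I); a subset X ⊆ V is a
  -- simplex iff  mem i ≐ X  for some i.  ℓ is defined on facets.

  record SData : Set₁ where
    field
      V   : Set
      _≈_ : V → V → Set
      I   : Set
      mem : I → Pred V
      χ   : V → A
      ℓ   : (i : I) → (∀ j → mem i ⊆ mem j → mem j ⊆ mem i) → Pred AP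

  module _ (C : SData) where
    open SData C

    Closed : Pred V → Set
    Closed X = ∀ u v → X u → u ≈ v → X v

    NonEmpty : Pred V → Set
    NonEmpty X = Σ V X

    InS : Pred V → Set
    InS X = Σ I λ i → mem i ≐ X

    IsFacet : I → Set
    IsFacet i = ∀ j → mem i ⊆ mem j → mem j ⊆ mem i

    Facet : Set
    Facet = Σ I IsFacet

    cols : Pred V → Pred A
    cols X a = Σ V λ v → X v × χ v ≡ a

  record IsSModel (C : SData) : Set₁ where
    open SData C
    field
      ≈-equiv      : IsEquivalence _≈_
      χ-resp       : ∀ u v → u ≈ v → χ u ≡ χ v
      mem-closed   : ∀ i → Closed C (mem i)
      mem-nonempty : ∀ i → NonEmpty C (mem i)
      singletons   : ∀ v → InS C (λ u → v ≈ u)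
      down-closed  : ∀ i (Y : Pred V) → Closed C Y → NonEmpty C Y → Y ⊆ mem i → InS C Y
      χ-inj        : ∀ i u v → mem i u → mem i v → χ u ≡ χ v → u ≈ v
      ℓ-ext        : ∀ i (fi : IsFacet C i) j (fj : IsFacet C j) → mem i ≐ mem j → ℓ i fi ≐ ℓ j fj

  SModel : Set₁
  SModel = Σ SData IsSModel

  image : (C D : SData) → (SData.V C → SData.V D) → Pred (SData.V C) → Pred (SData.V D)
  image C D f X w = Σ (SData.V C) λ v → X v × SData._≈_ D (f v) w

  record IsSMor (C D : SData) (f : SData.V C → SData.V D) : Set where
    module C = SData C
    module D = SData D
    field
      resp : ∀ u v → u C.≈ v → f u D.≈ f v
      simp : ∀ i → InS D (image C D f (C.mem i))
      col  : ∀ v → D.χ (f v) ≡ C.χ v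
      lab  : ∀ i (fi : IsFacet C i) j (fj : IsFacet D j) →
             image C D f (C.mem i) ⊆ D.mem j →
             AgreeOn (cols C (C.mem i)) (D.ℓ j fj) (C.ℓ i fi)

  record SMor (C D : SModel) : Set where
    constructor smor
    field
      fun   : SData.V (proj₁ C) → SData.V (proj₁ D)
      isMor : IsSMor (proj₁ C) (proj₁ D) fun
  open SMor public

  PointedSModel : Set₁
  PointedSModel = Σ SModel λ C → Facet (proj₁ C)

  IsPointed : (C D : SModel) → Facet (proj₁ C) → Facet (proj₁ D) →
              (SData.V (proj₁ C) → SData.V (proj₁ D)) → Set
  IsPointed C D X Y f =
    image (proj₁ C) (proj₁ D) f (SData.mem (proj₁ C) (proj₁ X)) ⊆ SData.mem (proj₁ D) (proj₁ Y)

  record EData : Set₁ where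
    field
      W     : Set
      _≈_   : W → W → Set
      _∼[_]_ : W → A → W → Set
      L     : W → Pred AP

  module _ (M : EData) where
    open EData M

    live : W → Pred A
    live w a = w ∼[ a ] w

    sat : Pred A → W → Pred W
    sat U w w' = ∀ a → U a → w ∼[ a ] w'

    Proper : Set
    Proper = ∀ w w' → Σ A λ a → (w ∼[ a ] w) × (¬ (w ≈ w') → ¬ (w ∼[ a ] w'))

  record IsEModel (M : EData) : Set where
    open EData M
    field
      ≈-equiv : IsEquivalence _≈_
      ∼-sym   : ∀ a u v → u ∼[ a ] v → v ∼[ a ] u
      ∼-trans : ∀ a u v w → u ∼[ a ] v → v ∼[ a ] w → u ∼[ a ] w
      ∼-resp  : ∀ a u u' v v' → u ≈ u' → v ≈ v' → u ∼[ a ] v → u' ∼[ a ] v'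
      L-resp  : ∀ u v → u ≈ v → L u ≐ L v

  PEModel : Set₁
  PEModel = Σ EData λ M → IsEModel M × Proper M

  record IsEMor (M N : EData) (h : EData.W M → Pred (EData.W N)) : Set where
    module M = EData M
    module N = EData N
    field
      resp : ∀ u u' v v' → u M.≈ u' → v N.≈ v' → h u v → h u' v'
      rel  : ∀ a u v → u M.∼[ a ] v → ∀ u' v' → h u u' → h v v' → u' N.∼[ a ] v'
      gen  : ∀ u → Σ N.W λ u' → h u u' × (h u ≐ sat N (live M u) u')
      lab  : ∀ u u' → h u u' → AgreeOn (live M u) (N.L u') (M.L u)

  record EMor (M N : PEModel) : Set₁ where
    constructor emor
    field
      rel    : EData.W (proj₁ M) → Pred (EData.W (proj₁ N))
      isEMor : IsEMor (proj₁ M) (proj₁ N) rel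
  open EMor public

  idE : (M : EData) → EData.W M → Pred (EData.W M)
  idE M u v = EData._≈_ M u v

  compE : (M N O : EData) → (EData.W M → Pred (EData.W N)) →
          (EData.W N → Pred (EData.W O)) → EData.W M → Pred (EData.W O)
  compE M N O f g u x =
    Σ (EData.W N) λ v → Σ (EData.W O) λ w → f u v × g v w × sat O (live M u) w x

  EqE : (M N : EData) → (EData.W M → Pred (EData.W N)) → (EData.W M → Pred (EData.W N)) → Set
  EqE M N h h' = ∀ u v → h u v ⟺ h' u v

  κ : SData → EData
  κ C = record
    { W      = Facet C
    ; _≈_    = λ X Y → mem (proj₁ X) ≐ mem (proj₁ Y)
    ; _∼[_]_ = λ X a Y → cols C (λ v → mem (proj₁ X) v × mem (proj₁ Y) v) a
    ; L      = λ X → ℓ (proj₁ X) (proj₂ X)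
    }
    where open SData C

  κfun : (C D : SData) → (SData.V C → SData.V D) → Facet C → Pred (Facet D)
  κfun C D f X Z = image C D f (SData.mem C (proj₁ X)) ⊆ SData.mem D (proj₁ Z)

  -- Vertex v^w_a = (a , [w]_a) is represented by
  -- (a , w , proof of a ∈ live(w)), with (a,w) ≈ (b,w') iff a ≡ b and w ∼_a w'.
  -- Simplexes: nonempty subsets of X_w, indexed by w and a (Boolean, A being
  -- finite) set of agents containing some agent live at w.

  Xw : (M : EData) → EData.W M → Pred (Σ A λ a → Σ (EData.W M) λ w → live M w a)
  Xw M w (a , w₁ , _) = EData._∼[_]_ M w a w₁

  σ : EData → SData
  σ M = record
    { V   = Σ A λ a → Σ W λ w → live M w a
    ; _≈_ = λ x y → (proj₁ x ≡ proj₁ y) × (proj₁ (proj₂ x) ∼[ proj₁ x ] proj₁ (proj₂ y))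
    ; I   = Σ W λ w → Σ (A → Bool) λ U → Σ A λ a → (U a ≡ true) × live M w a
    ; mem = λ i x → (proj₁ (proj₂ i) (proj₁ x) ≡ true) × Xw M (proj₁ i) x
    ; χ   = proj₁
    ; ℓ   = λ i _ p → Σ W λ w →
              ((λ x → (proj₁ (proj₂ i) (proj₁ x) ≡ true) × Xw M (proj₁ i) x) ≐ Xw M w)
              × L w p
    }
    where open EData M

  XwIdx : (M : EData) → (w : EData.W M) → (Σ A λ a → live M w a) → SData.I (σ M)
  XwIdx M w (a , la) = w , (λ _ → true) , a , refl , la

  -- σ(f)(v^w_a) = v^{w'}_a with w' ∈ f(w)  (the generator w' of f(w))
  σfun : (M N : EData) → (h : EData.W M → Pred (EData.W N)) → IsEMor M N h →
         SData.V (σ M) → SData.V (σ N)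
  σfun M N h hm (a , w , la) =
    a , proj₁ (IsEMor.gen hm w) ,
    IsEMor.rel hm a w w la (proj₁ (IsEMor.gen hm w)) (proj₁ (IsEMor.gen hm w))
      (proj₁ (proj₂ (IsEMor.gen hm w))) (proj₁ (proj₂ (IsEMor.gen hm w)))

  liveW : (M : PEModel) → (w : EData.W (proj₁ M)) → Σ A λ a → live (proj₁ M) w a
  liveW M w = proj₁ (proj₂ (proj₂ M) w w) , proj₁ (proj₂ (proj₂ (proj₂ M) w w))

  XwIx : (M : PEModel) → EData.W (proj₁ M) → SData.I (σ (proj₁ M))
  XwIx M w = XwIdx (proj₁ M) w (liveW M w)

  record WellDefined : Set₁ where
    field
      κ-obj    : ∀ (C : SModel) → IsEModel (κ (proj₁ C)) × Proper (κ (proj₁ C))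
      σ-obj    : ∀ (M : PEModel) → IsSModel (σ (proj₁ M))
      κ-mor    : ∀ (C D : SModel) (f : SMor C D) →
                 IsEMor (κ (proj₁ C)) (κ (proj₁ D)) (κfun (proj₁ C) (proj₁ D) (fun f))
      σ-mor    : ∀ (M N : PEModel) (f : EMor M N) →
                 IsSMor (σ (proj₁ M)) (σ (proj₁ N)) (σfun (proj₁ M) (proj₁ N) (rel f) (isEMor f))
      σ-pt-obj : ∀ (M : PEModel) (w : EData.W (proj₁ M)) → IsFacet (σ (proj₁ M)) (XwIx M w)
      σ-pt-mor : ∀ (M N : PEModel) (f : EMor M N) (w : EData.W (proj₁ M)) (w' : EData.W (proj₁ N)) →
                 rel f w w' →
                 image (σ (proj₁ M)) (σ (proj₁ N)) (σfun (proj₁ M) (proj₁ N) (rel f) (isEMor f))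
                   (SData.mem (σ (proj₁ M)) (XwIx M w))
                   ⊆ SData.mem (σ (proj₁ N)) (XwIx N w')

  module Functors (wd : WellDefined) where
    open WellDefined wd

    κO : SModel → PEModel
    κO C = κ (proj₁ C) , κ-obj C

    σO : PEModel → SModel
    σO M = σ (proj₁ M) , σ-obj M

    κM : (C D : SModel) → SMor C D → EMor (κO C) (κO D)
    κM C D f = emor (κfun (proj₁ C) (proj₁ D) (fun f)) (κ-mor C D f)

    σM : (M N : PEModel) → EMor M N → SMor (σO M) (σO N)
    σM M N f = smor (σfun (proj₁ M) (proj₁ N) (rel f) (isEMor f)) (σ-mor M N f)

    -- pointed: κ(C,X) = (κ(C),X),  σ(M,w) = (σ(M),X_w)
    σpt : (M : PEModel) → EData.W (proj₁ M) → Facet (proj₁ (σO M))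
    σpt M w = XwIx M w , σ-pt-obj M w

    Eq : (C : SModel) → SData.V (proj₁ C) → SData.V (proj₁ C) → Set
    Eq C = SData._≈_ (proj₁ C)

    W : PEModel → Set
    W M = EData.W (proj₁ M)

    comp : (M N O : PEModel) → (W M → Pred (W N)) → (W N → Pred (W O)) → W M → Pred (W O)
    comp M N O = compE (proj₁ M) (proj₁ N) (proj₁ O)

  record Equivalence (wd : WellDefined) : Set₁ where
    open Functors wd
    field
      η      : ∀ C → SMor C (σO (κO C))
      η⁻¹    : ∀ C → SMor (σO (κO C)) C
      η-iso₁ : ∀ C v → Eq C (fun (η⁻¹ C) (fun (η C) v)) v
      η-iso₂ : ∀ C x → Eq (σO (κO C)) (fun (η C) (fun (η⁻¹ C) x)) x
      η-nat  : ∀ C D (f : SMor C D) v →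
               Eq (σO (κO D)) (fun (η D) (fun f v))
                 (fun (σM (κO C) (κO D) (κM C D f)) (fun (η C) v))
      ε      : ∀ M → EMor M (κO (σO M))
      ε⁻¹    : ∀ M → EMor (κO (σO M)) M
      ε-iso₁ : ∀ M → EqE (proj₁ M) (proj₁ M)
                       (comp M (κO (σO M)) M (rel (ε M)) (rel (ε⁻¹ M))) (idE (proj₁ M))
      ε-iso₂ : ∀ M → EqE (proj₁ (κO (σO M))) (proj₁ (κO (σO M)))
                       (comp (κO (σO M)) M (κO (σO M)) (rel (ε⁻¹ M)) (rel (ε M)))
                       (idE (proj₁ (κO (σO M))))
      ε-nat  : ∀ M N (f : EMor M N) → EqE (proj₁ M) (proj₁ (κO (σO N)))
               (comp M (κO (σO M)) (κO (σO N)) (rel (ε M)) (rel (κM (σO M) (σO N) (σM M N f))))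
               (comp M N (κO (σO N)) (rel f) (rel (ε N)))

  record PointedEquivalence (wd : WellDefined) : Set₁ where
    open Functors wd
    field
      η      : ∀ C (X : Facet (proj₁ C)) → Σ (SMor C (σO (κO C))) λ g →
                 IsPointed C (σO (κO C)) X (σpt (κO C) X) (fun g)
      η⁻¹    : ∀ C (X : Facet (proj₁ C)) → Σ (SMor (σO (κO C)) C) λ g →
                 IsPointed (σO (κO C)) C (σpt (κO C) X) X (fun g)
      η-iso₁ : ∀ C X v → Eq C (fun (proj₁ (η⁻¹ C X)) (fun (proj₁ (η C X)) v)) v
      η-iso₂ : ∀ C X x → Eq (σO (κO C)) (fun (proj₁ (η C X)) (fun (proj₁ (η⁻¹ C X)) x)) x
      η-nat  : ∀ C X D Y (f : SMor C D) → IsPointed C D X Y (fun f) → ∀ v →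
               Eq (σO (κO D)) (fun (proj₁ (η D Y)) (fun f v))
                 (fun (σM (κO C) (κO D) (κM C D f)) (fun (proj₁ (η C X)) v))
      ε      : ∀ M (w : W M) → Σ (EMor M (κO (σO M))) λ g → rel g w (σpt M w)
      ε⁻¹    : ∀ M (w : W M) → Σ (EMor (κO (σO M)) M) λ g → rel g (σpt M w) w
      ε-iso₁ : ∀ M w → EqE (proj₁ M) (proj₁ M)
                         (comp M (κO (σO M)) M (rel (proj₁ (ε M w))) (rel (proj₁ (ε⁻¹ M w))))
                         (idE (proj₁ M))
      ε-iso₂ : ∀ M w → EqE (proj₁ (κO (σO M))) (proj₁ (κO (σO M)))
                         (comp (κO (σO M)) M (κO (σO M)) (rel (proj₁ (ε⁻¹ M w))) (rel (proj₁ (ε M w))))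
                         (idE (proj₁ (κO (σO M))))
      ε-nat  : ∀ M w N w' (f : EMor M N) → rel f w w' → EqE (proj₁ M) (proj₁ (κO (σO N)))
               (comp M (κO (σO M)) (κO (σO N)) (rel (proj₁ (ε M w))) (rel (κM (σO M) (σO N) (σM M N f))))
               (comp M N (κO (σO N)) (rel f) (rel (proj₁ (ε N w'))))

  record Theorem29 : Set₁ where
    field
      wellDefined : WellDefined
      equivalence : Equivalence wellDefined
      pointed     : PointedEquivalence wellDefined

{-# OPTIONS --safe #-}
module Submission where

-- A vertex v of a simplicial model C corresponds to the vertex (χ v, [X]_{χ v}) of σκC for any facet
-- X ∋ v: facets sharing a vertex of colour a are a-indistinguishable in κC, and χ is injective on
-- simplexes, so this is a bijection. A world w of a proper partial epistemic model M corresponds to the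
-- facet X_w of σM: properness says precisely that w is determined by its classes [w]_a, a ∈ live(w).
-- Excluded middle is used to decide memberships (e.g. to form colour sets as Booleans), and finiteness
-- of A to find a facet above every simplex.

open import Axiom.ExcludedMiddle using (ExcludedMiddle)
open import Data.Bool using (Bool; true)
open import Data.Fin using (Fin)
open import Data.Fin.Subset using (Subset) renaming (_∈_ to _∈ₛ_; _⊆_ to _⊆ₛ_; _⊂_ to _⊂ₛ_; _⊃_ to _⊃ₛ_)
open import Data.Fin.Subset.Induction using (⊃-wellFounded)
open import Data.Nat using (ℕ; suc)
open import Data.Product using (Σ; _×_; _,_; proj₁; proj₂)
open import Data.Vec using (tabulate)
open import Data.Vec.Properties using (lookup∘tabulate; []=⇒lookup; lookup⇒[]=)
open import Function.Base using (_∘_)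
open import Function.Bundles using (_↔_; _↣_; Injection)
open import Function.Properties.Inverse using (↔⇒↣)
open import Induction.WellFounded using (Acc; acc)
open import Level using (0ℓ; lift; lower)
open import Relation.Binary.PropositionalEquality using (_≡_; refl; sym; trans)
open import Relation.Binary.Structures using (IsEquivalence)
open import Relation.Nullary using (¬_; Dec; yes; no; does)
open import Relation.Nullary.Decidable using (map′; dec-true; decidable-stable)

open import Defs

≐-refl : {X : Set} {P : Pred X} → P ≐ P
≐-refl = (λ _ p → p) , (λ _ p → p)

≐-sym : {X : Set} {P Q : Pred X} → P ≐ Q → Q ≐ P
≐-sym (P⊆Q , Q⊆P) = Q⊆P , P⊆Q

≐-trans : {X : Set} {P Q R : Pred X} → P ≐ Q → Q ≐ R → P ≐ R
≐-trans (P⊆Q , Q⊆P) (Q⊆R , R⊆Q) = (λ x p → Q⊆R x (P⊆Q x p)) , (λ x r → Q⊆P x (R⊆Q x r))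

≐⇒⟺ : {X : Set} {P Q : Pred X} → P ≐ Q → ∀ x → P x ⟺ Q x
≐⇒⟺ (P⊆Q , Q⊆P) x = P⊆Q x , Q⊆P x

⟺-sym : {P Q : Set} → P ⟺ Q → Q ⟺ P
⟺-sym (to , from) = from , to

⟺-trans : {P Q R : Set} → P ⟺ Q → Q ⟺ R → P ⟺ R
⟺-trans (to₁ , from₁) (to₂ , from₂) = (λ p → to₂ (to₁ p)) , (λ r → from₁ (from₂ r))

module Classical (em : ExcludedMiddle (Level.suc 0ℓ)) where

  dec : (P : Set) → Dec P
  dec P = map′ lower lift em

  stable : {P : Set} → ¬ ¬ P → P
  stable {P} = decidable-stable (dec P)

  decide : Set → Bool
  decide P = does (dec P)

  decide-true⁺ : {P : Set} → P → decide P ≡ true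
  decide-true⁺ {P} = dec-true (dec P)

  decide-true⁻ : {P : Set} → decide P ≡ true → P
  decide-true⁻ {P} = does-true⁻ (dec P)
    where
    does-true⁻ : (P? : Dec P) → does P? ≡ true → P
    does-true⁻ (yes p) _ = p

  subset : {m : ℕ} → (Fin m → Set) → Subset m
  subset P = tabulate (λ k → decide (P k))

  ∈-subset⁺ : {m : ℕ} {P : Fin m → Set} {k : Fin m} → P k → k ∈ₛ subset P
  ∈-subset⁺ {P = P} {k} p = lookup⇒[]= k (subset P) (trans (lookup∘tabulate _ k) (decide-true⁺ p))

  ∈-subset⁻ : {m : ℕ} {P : Fin m → Set} {k : Fin m} → k ∈ₛ subset P → P k
  ∈-subset⁻ {k = k} k∈ = decide-true⁻ (trans (sym (lookup∘tabulate _ k)) ([]=⇒lookup k∈))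

module KappaSigma (em : ExcludedMiddle (Level.suc 0ℓ)) (A : Set) {m : ℕ} (ι : A ↣ Fin m)
                  (AP : Set) (own : AP → A) where
  open Setup A AP own
  open Classical em
  open Injection ι using (injective) renaming (to to index)

  module SModelProperties {C : SData} (isC : IsSModel C) where
    open SData C
    open IsSModel isC
    open IsEquivalence ≈-equiv using () renaming (refl to ≈-refl)

    ∈-by-colour : ∀ i j {u v} → mem i u → mem i v → χ u ≡ χ v → mem j u → mem j v
    ∈-by-colour i j {u} {v} iu iv χu≡χv ju = mem-closed j u v ju (χ-inj i u v iu iv χu≡χv)

    colours : Pred V → Subset m
    colours X = subset (λ k → Σ V λ v → X v × index (χ v) ≡ k)

    colours-⊂ : ∀ {i j v} → mem i ⊆ mem j → mem j v → ¬ mem i v → colours (mem i) ⊂ₛ colours (mem j)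
    colours-⊂ {i} {j} {v} i⊆j jv ¬iv = grow , index (χ v) , ∈-subset⁺ (v , jv , refl) , new
      where
      grow : colours (mem i) ⊆ₛ colours (mem j)
      grow k∈ with ∈-subset⁻ k∈
      ... | u , iu , χu↦k = ∈-subset⁺ (u , i⊆j u iu , χu↦k)
      new : ¬ index (χ v) ∈ₛ colours (mem i)
      new χv∈ with ∈-subset⁻ χv∈
      ... | u , iu , χu↦χv = ¬iv (∈-by-colour j i (i⊆j u iu) jv (injective χu↦χv) iu)

    -- A simplex that is not a facet lies in one with strictly more colours, and there are finitely many.
    facet-above : ∀ i → Σ (Facet C) λ Z → mem i ⊆ mem (proj₁ Z)
    facet-above i = go i (⊃-wellFounded (colours (mem i)))
      where
      go : ∀ i → Acc _⊃ₛ_ (colours (mem i)) → Σ (Facet C) λ Z → mem i ⊆ mem (proj₁ Z)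
      go i (acc larger) with dec (Σ I λ j → Σ V λ v → mem i ⊆ mem j × mem j v × ¬ mem i v)
      ... | yes (j , v , i⊆j , jv , ¬iv) =
        let Z , j⊆Z = go j (larger (colours-⊂ i⊆j jv ¬iv)) in Z , λ x ix → j⊆Z x (i⊆j x ix)
      ... | no maximal =
        (i , λ j i⊆j v jv → stable λ ¬iv → maximal (j , v , i⊆j , jv , ¬iv)) , λ _ ix → ix

    facet-of : V → Facet C
    facet-of v = proj₁ (facet-above (proj₁ (singletons v)))

    ∈-facet-of : ∀ v → mem (proj₁ (facet-of v)) v
    ∈-facet-of v = proj₂ (facet-above _) v (proj₂ (proj₂ (singletons v)) v ≈-refl)

    κ-isEModel : IsEModel (κ C)
    κ-isEModel = record
      { ≈-equiv = record { refl = ≐-refl ; sym = ≐-sym ; trans = ≐-trans }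
      ; ∼-sym   = λ { _ _ _ (v , (xv , yv) , χv≡a) → v , (yv , xv) , χv≡a }
      ; ∼-trans = λ { _ X Y _ (u , (xu , yu) , χu≡a) (v , (yv , zv) , χv≡a) →
                      v , (∈-by-colour (proj₁ Y) (proj₁ X) yu yv (trans χu≡a (sym χv≡a)) xu , zv) , χv≡a }
      ; ∼-resp  = λ { _ _ _ _ _ X≐X′ Y≐Y′ (v , (xv , yv) , χv≡a) →
                      v , (proj₁ X≐X′ v xv , proj₁ Y≐Y′ v yv) , χv≡a }
      ; L-resp  = λ X Y → ℓ-ext (proj₁ X) (proj₂ X) (proj₁ Y) (proj₂ Y)
      }

    -- The colour of a vertex of X outside Y separates X from Y; if there is none, X = Y by maximality.
    κ-proper : Proper (κ C)
    κ-proper X Y with dec (Σ V λ v → mem (proj₁ X) v × ¬ mem (proj₁ Y) v)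
    ... | yes (v , xv , ¬yv) =
      χ v , (v , (xv , xv) , refl) ,
      λ { _ (u , (xu , yu) , χu≡χv) → ¬yv (∈-by-colour (proj₁ X) (proj₁ Y) xu xv χu≡χv yu) }
    ... | no ¬outside =
      let v , xv = mem-nonempty (proj₁ X) in
      χ v , (v , (xv , xv) , refl) , λ X≉Y _ → X≉Y (X⊆Y , proj₂ X (proj₁ Y) X⊆Y)
      where
      X⊆Y : mem (proj₁ X) ⊆ mem (proj₁ Y)
      X⊆Y v xv = stable λ ¬yv → ¬outside (v , xv , ¬yv)

  module PEModelProperties {M : EData} (isM : IsEModel M) (proper : Proper M) where
    open EData M
    open IsEModel isM using (≈-equiv; L-resp)
    open IsEquivalence ≈-equiv using () renaming (refl to ≈-refl; sym to ≈-sym)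
    module S = SData (σ M)

    ∼-sym : ∀ {a u v} → u ∼[ a ] v → v ∼[ a ] u
    ∼-sym = IsEModel.∼-sym isM _ _ _

    ∼-trans : ∀ {a u v w} → u ∼[ a ] v → v ∼[ a ] w → u ∼[ a ] w
    ∼-trans = IsEModel.∼-trans isM _ _ _ _

    ∼-resp : ∀ {a u u′ v v′} → u ≈ u′ → v ≈ v′ → u ∼[ a ] v → u′ ∼[ a ] v′
    ∼-resp = IsEModel.∼-resp isM _ _ _ _ _

    ∼⇒liveˡ : ∀ {a u v} → u ∼[ a ] v → live M u a
    ∼⇒liveˡ u∼v = ∼-trans u∼v (∼-sym u∼v)

    sat⇒≈ : ∀ {u w} → sat M (live M u) u w → u ≈ w
    sat⇒≈ {u} {w} u∼w with proper u w
    ... | a , live-a , separates = stable λ u≉w → separates u≉w (u∼w a live-a)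

    ≈⇒sat : ∀ {u w} → u ≈ w → sat M (live M u) u w
    ≈⇒sat u≈w _ live-a = ∼-resp ≈-refl u≈w live-a

    ≈-sat⇒≈ : ∀ {u v w} → u ≈ v → sat M (live M u) v w → u ≈ w
    ≈-sat⇒≈ u≈v v∼w = sat⇒≈ λ a live-a → ∼-trans (≈⇒sat u≈v a live-a) (v∼w a live-a)

    Xw⊆⇒≈ : ∀ {u w} → Xw M u ⊆ Xw M w → u ≈ w
    Xw⊆⇒≈ {u} Xu⊆Xw = sat⇒≈ λ a live-a → ∼-sym (Xu⊆Xw (a , u , live-a) live-a)

    Xw≐⇒≈ : ∀ {u w} → Xw M u ≐ Xw M w → u ≈ w
    Xw≐⇒≈ Xu≐Xw = Xw⊆⇒≈ (proj₁ Xu≐Xw)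

    ≈⇒Xw≐ : ∀ {u w} → u ≈ w → Xw M u ≐ Xw M w
    ≈⇒Xw≐ u≈w = (λ _ → ∼-resp u≈w ≈-refl) , (λ _ → ∼-resp (≈-sym u≈w) ≈-refl)

    σ-≈-refl : ∀ {x} → x S.≈ x
    σ-≈-refl {_ , _ , live-a} = refl , live-a

    σ-≈-trans : ∀ {x y z} → x S.≈ y → y S.≈ z → x S.≈ z
    σ-≈-trans {_ , _ , _} {_ , _ , _} {_ , _ , _} (refl , u∼v) (refl , v∼w) = refl , ∼-trans u∼v v∼w

    σ-≈-equiv : IsEquivalence S._≈_
    σ-≈-equiv = record
      { refl  = λ {x} → σ-≈-refl {x}
      ; sym   = λ { {_ , _ , _} {_ , _ , _} (refl , u∼v) → refl , ∼-sym u∼v }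
      ; trans = λ {x} {y} {z} → σ-≈-trans {x} {y} {z}
      }

    σ-mem-closed : ∀ i → Closed (σ M) (S.mem i)
    σ-mem-closed _ (_ , _ , _) (_ , _ , _) (Ua , w∼u) (refl , u∼v) = Ua , ∼-trans w∼u u∼v

    σ-down-closed : ∀ i (Y : Pred S.V) → Closed (σ M) Y → NonEmpty (σ M) Y → Y ⊆ S.mem i → InS (σ M) Y
    σ-down-closed (w , _ , _) Y closed (x@(a , _ , _) , Yx) Y⊆i =
      (w , colours-of-Y , a , decide-true⁺ (x , Yx , refl) , ∼⇒liveˡ (proj₂ (Y⊆i x Yx))) ,
      (λ { (_ , _ , _) (b∈Y , w∼v) → in-Y (decide-true⁻ b∈Y) w∼v }) ,
      (λ x Yx → decide-true⁺ (x , Yx , refl) , proj₂ (Y⊆i x Yx))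
      where
      colours-of-Y : A → Bool
      colours-of-Y b = decide (Σ S.V λ x → Y x × proj₁ x ≡ b)
      in-Y : ∀ {b v live-b} → (Σ S.V λ x → Y x × proj₁ x ≡ b) → w ∼[ b ] v → Y (b , v , live-b)
      in-Y (x , Yx , refl) w∼v = closed x _ Yx (refl , ∼-trans (∼-sym (proj₂ (Y⊆i x Yx))) w∼v)

    σ-singletons : ∀ x → InS (σ M) (x S.≈_)
    σ-singletons x@(a , w , live-a) =
      σ-down-closed (XwIdx M w (a , live-a)) (x S.≈_)
        (λ y z → σ-≈-trans {x} {y} {z}) (x , σ-≈-refl {x}) (λ { (_ , _ , _) (refl , w∼v) → refl , w∼v })

    σ-isSModel : IsSModel (σ M)
    σ-isSModel = record
      { ≈-equiv      = σ-≈-equiv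
      ; χ-resp       = λ _ _ → proj₁
      ; mem-closed   = σ-mem-closed
      ; mem-nonempty = λ { (w , _ , a , Ua , live-a) → (a , w , live-a) , Ua , live-a }
      ; singletons   = σ-singletons
      ; down-closed  = σ-down-closed
      ; χ-inj        = λ { _ (_ , _ , _) (_ , _ , _) (_ , w∼u) (_ , w∼v) refl → refl , ∼-trans (∼-sym w∼u) w∼v }
      ; ℓ-ext        = λ _ _ _ _ i≐j → (λ _ (w , i≐Xw , Lw) → w , ≐-trans (≐-sym i≐j) i≐Xw , Lw) ,
                                        (λ _ (w , j≐Xw , Lw) → w , ≐-trans i≐j j≐Xw , Lw)
      }

    Xw-isFacet : ∀ w live-w → IsFacet (σ M) (XwIdx M w live-w)
    Xw-isFacet w _ (w′ , _) Xw⊆j (_ , _ , _) (_ , w′∼v) = refl , ∼-resp (≈-sym w≈w′) ≈-refl w′∼v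
      where
      w≈w′ : w ≈ w′
      w≈w′ = sat⇒≈ λ a live-a → ∼-sym (proj₂ (Xw⊆j (a , w , live-a) (refl , live-a)))

    facet-mem : ∀ i → IsFacet (σ M) i → S.mem i ≐ Xw M (proj₁ i)
    facet-mem (w , _ , a , _ , live-a) maximal =
      (λ _ → proj₂) , (λ x w∼x → maximal (XwIdx M w (a , live-a)) (λ _ → (refl ,_) ∘ proj₂) x (refl , w∼x))

    σ-ℓ⟺L-at : ∀ i (fi : IsFacet (σ M) i) {w} → S.mem i ≐ Xw M w → ∀ p → S.ℓ i fi p ⟺ L w p
    σ-ℓ⟺L-at i fi {w} i≐Xw p =
      (λ (u , i≐Xu , Lu) → proj₁ (L-resp u w (Xw≐⇒≈ (≐-trans (≐-sym i≐Xu) i≐Xw))) p Lu) ,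
      (λ Lw → w , i≐Xw , Lw)

    σ-ℓ⟺L : ∀ i (fi : IsFacet (σ M) i) p → S.ℓ i fi p ⟺ L (proj₁ i) p
    σ-ℓ⟺L i fi = σ-ℓ⟺L-at i fi (facet-mem i fi)

  module κ-OnMorphisms {C D : SData} (isD : IsSModel D) {f : SData.V C → SData.V D} (isf : IsSMor C D f)
    where
    module SC = SData C
    open SData D
    open IsSModel isD using (mem-closed; χ-inj; ≈-equiv)
    open IsEquivalence ≈-equiv using () renaming (refl to ≈-refl; trans to ≈-trans)
    open SModelProperties isD using (facet-above)
    open IsSMor isf renaming (simp to f-simp; col to f-col; lab to f-lab)

    ∈-image : ∀ {X v} → X v → image C D f X (f v)
    ∈-image {v = v} Xv = v , Xv , ≈-refl

    image-facet : Facet C → Facet D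
    image-facet X = proj₁ (facet-above (proj₁ (f-simp (proj₁ X))))

    image⊆image-facet : ∀ X → κfun C D f X (image-facet X)
    image⊆image-facet X y fXy = proj₂ (facet-above _) y (proj₂ (proj₂ (f-simp (proj₁ X))) y fXy)

    κfun⊆sat : ∀ X → κfun C D f X ⊆ sat (κ D) (live (κ C) X) (image-facet X)
    κfun⊆sat X Z fX⊆Z _ (v , (xv , _) , χv≡a) =
      f v , (image⊆image-facet X (f v) (∈-image xv) , fX⊆Z (f v) (∈-image xv)) , trans (f-col v) χv≡a

    -- Each y ∈ f(X) shares its colour with a vertex of image-facet X ∩ Z, which by χ-injectivity is y.
    sat⊆κfun : ∀ X → sat (κ D) (live (κ C) X) (image-facet X) ⊆ κfun C D f X
    sat⊆κfun X Z X∼Z y (v , xv , fv≈y) with X∼Z (SC.χ v) (v , (xv , xv) , refl)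
    ... | u , (u∈fX , zu) , χu≡χv =
      mem-closed (proj₁ Z) u y zu
        (≈-trans (χ-inj _ u (f v) u∈fX (image⊆image-facet X (f v) (∈-image xv)) (trans χu≡χv (sym (f-col v))))
                 fv≈y)

    κ-isEMor : IsEMor (κ C) (κ D) (κfun C D f)
    κ-isEMor = record
      { resp = λ _ _ _ _ X≐X′ Z≐Z′ fX⊆Z y (v , x′v , fv≈y) →
                 proj₁ Z≐Z′ y (fX⊆Z y (v , proj₂ X≐X′ v x′v , fv≈y))
      ; rel  = λ { _ _ _ (v , (xv , yv) , χv≡a) _ _ fX⊆Z fY⊆Z′ →
                   f v , (fX⊆Z (f v) (∈-image xv) , fY⊆Z′ (f v) (∈-image yv)) , trans (f-col v) χv≡a }
      ; gen  = λ X → image-facet X , image⊆image-facet X , κfun⊆sat X , sat⊆κfun X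
      ; lab  = λ { X Z fX⊆Z p (v , (xv , _) , χv≡own) →
                   f-lab (proj₁ X) (proj₂ X) (proj₁ Z) (proj₂ Z) fX⊆Z p (v , xv , χv≡own) }
      }

  module σ-OnMorphisms (M N : PEModel) (h : EMor M N) where
    M₀ N₀ : EData
    M₀ = proj₁ M
    N₀ = proj₁ N

    open EData M₀ using (W; _∼[_]_)
    open EData N₀ using () renaming (_∼[_]_ to _∼ᴺ[_]_)
    module PM = PEModelProperties (proj₁ (proj₂ M)) (proj₂ (proj₂ M))
    module PN = PEModelProperties (proj₁ (proj₂ N)) (proj₂ (proj₂ N))
    module SM = SData (σ M₀)
    module SN = SData (σ N₀)
    open IsEMor (isEMor h) using (gen) renaming (lab to h-lab)

    g : W → EData.W N₀
    g w = proj₁ (gen w)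

    h-g : ∀ w → rel h w (g w)
    h-g w = proj₁ (proj₂ (gen w))

    h⇒sat : ∀ {w v} → rel h w v → sat N₀ (live M₀ w) (g w) v
    h⇒sat {w} = proj₁ (proj₂ (proj₂ (gen w))) _

    sat⇒h : ∀ {w v} → sat N₀ (live M₀ w) (g w) v → rel h w v
    sat⇒h {w} = proj₂ (proj₂ (proj₂ (gen w))) _

    h-rel : ∀ {a u v u′ v′} → u ∼[ a ] v → rel h u u′ → rel h v v′ → u′ ∼ᴺ[ a ] v′
    h-rel u∼v = IsEMor.rel (isEMor h) _ _ _ u∼v _ _

    σh : SM.V → SN.V
    σh = σfun M₀ N₀ (rel h) (isEMor h)

    σh-simp : ∀ i → InS (σ N₀) (image (σ M₀) (σ N₀) σh (SM.mem i))
    σh-simp (w , U , a , Ua , live-a) =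
      (g w , U′ , a , decide-true⁺ (Ua , live-a) , h-rel live-a (h-g w) (h-g w)) ,
      (λ { (b , _ , _) (U′b , gw∼v) →
           let Ub , live-b = decide-true⁻ U′b in (b , w , live-b) , (Ub , live-b) , (refl , gw∼v) }) ,
      (λ { (_ , _ , _) ((_ , u , _) , (Ub , w∼u) , (refl , gu∼v)) →
           decide-true⁺ (Ub , PM.∼⇒liveˡ w∼u) , PN.∼-trans (h-rel w∼u (h-g w) (h-g u)) gu∼v })
      where
      U′ : A → Bool
      U′ b = decide ((U b ≡ true) × live M₀ w b)

    σh-facets⇒h : ∀ i → IsFacet (σ M₀) i → ∀ j → image (σ M₀) (σ N₀) σh (SM.mem i) ⊆ SN.mem j →
                  rel h (proj₁ i) (proj₁ j)
    σh-facets⇒h i@(w , _) fi j σh[i]⊆j = sat⇒h λ a live-a →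
      let x = a , w , live-a in
      PN.∼-sym (proj₂ (σh[i]⊆j (σh x) (x , proj₂ (PM.facet-mem i fi) x live-a , PN.σ-≈-refl {σh x})))

    σh-isSMor : IsSMor (σ M₀) (σ N₀) σh
    σh-isSMor = record
      { resp = λ { (_ , u , _) (_ , v , _) (refl , u∼v) → refl , h-rel u∼v (h-g u) (h-g v) }
      ; simp = σh-simp
      ; col  = λ _ → refl
      ; lab  = λ { i fi j fj σh[i]⊆j p (x , ix , refl) →
                   ⟺-trans (PN.σ-ℓ⟺L j fj p)
                     (⟺-trans (h-lab _ _ (σh-facets⇒h i fi j σh[i]⊆j) p
                                      (PM.∼⇒liveˡ (proj₁ (PM.facet-mem i fi) x ix)))
                              (⟺-sym (PM.σ-ℓ⟺L i fi p))) }
      }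

    σh-pointed : ∀ w w′ → rel h w w′ → image (σ M₀) (σ N₀) σh (SM.mem (XwIx M w)) ⊆ SN.mem (XwIx N w′)
    σh-pointed w w′ hww′ (_ , _ , _) ((_ , u , _) , (_ , w∼u) , (refl , gu∼v)) =
      refl , PN.∼-trans (h-rel w∼u hww′ (h-g u)) gu∼v

  module Unit {C : SData} (isC : IsSModel C) where
    open SData C
    open IsSModel isC
    open IsEquivalence ≈-equiv using () renaming (refl to ≈-refl; sym to ≈-sym; trans to ≈-trans)
    open SModelProperties isC
    open EData (κ C) using () renaming (_∼[_]_ to _∼ᴷ[_]_)
    module K = PEModelProperties κ-isEModel κ-proper
    module SK = SData (σ (κ C))

    vertex-of : (X : Facet C) → ∀ {v} → mem (proj₁ X) v → SK.V
    vertex-of X {v} xv = χ v , X , v , (xv , xv) , refl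

    facet : SK.V → Facet C
    facet (_ , X , _) = X

    shared-colour⇒∈ : ∀ (Z X : Facet C) {v} → mem (proj₁ Z) v → Z ∼ᴷ[ χ v ] X → mem (proj₁ X) v
    shared-colour⇒∈ Z X zv (u , (zu , xu) , χu≡χv) = ∈-by-colour (proj₁ Z) (proj₁ X) zu zv χu≡χv xu

    η : V → SK.V
    η v = vertex-of (facet-of v) (∈-facet-of v)

    η⁻¹ : SK.V → V
    η⁻¹ (_ , _ , v , _) = v

    η-≈⇒∈ : ∀ {v} x → η v SK.≈ x → mem (proj₁ (facet x)) v
    η-≈⇒∈ {v} x (_ , F∼X) = shared-colour⇒∈ (facet-of v) (facet x) (∈-facet-of v) F∼X

    Xw⇒∈ : ∀ X x → Xw (κ C) X x → mem (proj₁ X) (η⁻¹ x)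
    Xw⇒∈ X (_ , Y , _ , (yv , _) , χv≡b) (u , (xu , yu) , χu≡b) =
      ∈-by-colour (proj₁ Y) (proj₁ X) yu yv (trans χu≡b (sym χv≡b)) xu

    η-simp : ∀ i → InS (σ (κ C)) (image C (σ (κ C)) η (mem i))
    η-simp i with facet-above i | mem-nonempty i
    ... | Z , i⊆Z | v₀ , iv₀ =
      (Z , colours-of-i , χ v₀ , decide-true⁺ (v₀ , iv₀ , refl) , (v₀ , (i⊆Z v₀ iv₀ , i⊆Z v₀ iv₀) , refl)) ,
      (λ { x@(_ , _ , _) (i-b , Z∼X) → from-colour x (decide-true⁻ i-b) Z∼X }) ,
      (λ { x (v , iv , ηv≈x) →
           decide-true⁺ (v , iv , proj₁ ηv≈x) , (v , (i⊆Z v iv , η-≈⇒∈ x ηv≈x) , proj₁ ηv≈x) })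
      where
      colours-of-i : A → Bool
      colours-of-i b = decide (cols C (mem i) b)
      from-colour : ∀ x → cols C (mem i) (proj₁ x) → Z ∼ᴷ[ proj₁ x ] facet x → image C (σ (κ C)) η (mem i) x
      from-colour x@(_ , _ , _) (v , iv , refl) Z∼X =
        v , iv , (refl , (v , (∈-facet-of v , shared-colour⇒∈ Z (facet x) (i⊆Z v iv) Z∼X) , refl))

    η-facets⇒≐ : ∀ i → IsFacet C i → ∀ j → IsFacet (σ (κ C)) j → image C (σ (κ C)) η (mem i) ⊆ SK.mem j →
                 mem i ≐ mem (proj₁ (proj₁ j))
    η-facets⇒≐ i fi j fj η[i]⊆j = i⊆Y , fi _ i⊆Y
      where
      i⊆Y : mem i ⊆ mem (proj₁ (proj₁ j))
      i⊆Y v iv = shared-colour⇒∈ (facet-of v) (proj₁ j) (∈-facet-of v)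
                   (K.∼-sym {χ v} {proj₁ j} {facet-of v}
                     (proj₁ (K.facet-mem j fj) (η v) (η[i]⊆j (η v) (v , iv , K.σ-≈-refl {η v}))))

    η-isSMor : IsSMor C (σ (κ C)) η
    η-isSMor = record
      { resp = λ u v u≈v →
                 χ-resp u v u≈v , (u , (∈-facet-of u , mem-closed _ v u (∈-facet-of v) (≈-sym u≈v)) , refl)
      ; simp = η-simp
      ; col  = λ _ → refl
      ; lab  = λ i fi j fj η[i]⊆j p _ →
                 ⟺-trans (K.σ-ℓ⟺L j fj p)
                         (⟺-sym (≐⇒⟺ (ℓ-ext i fi _ (proj₂ (proj₁ j)) (η-facets⇒≐ i fi j fj η[i]⊆j)) p))
      }

    η⁻¹-simp : ∀ i → InS C (image (σ (κ C)) C η⁻¹ (SK.mem i))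
    η⁻¹-simp (X , _ , a , Ua , live-a@(v , _)) =
      down-closed (proj₁ X) _
        (λ { _ _ (x , ix , η⁻¹x≈u) u≈w → x , ix , ≈-trans η⁻¹x≈u u≈w })
        (v , (a , X , live-a) , (Ua , live-a) , ≈-refl)
        (λ { u (x , (_ , X∼x) , η⁻¹x≈u) → mem-closed (proj₁ X) _ u (Xw⇒∈ X x X∼x) η⁻¹x≈u })

    η⁻¹-facets⇒≐ : ∀ i → IsFacet (σ (κ C)) i → ∀ j → image (σ (κ C)) C η⁻¹ (SK.mem i) ⊆ mem j →
                   mem (proj₁ (proj₁ i)) ≐ mem j
    η⁻¹-facets⇒≐ i fi j η⁻¹[i]⊆j = X⊆j , proj₂ (proj₁ i) j X⊆j
      where
      X⊆j : mem (proj₁ (proj₁ i)) ⊆ mem j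
      X⊆j v xv = let x = vertex-of (proj₁ i) xv in
                 η⁻¹[i]⊆j v (x , proj₂ (K.facet-mem i fi) x (v , (xv , xv) , refl) , ≈-refl)

    η⁻¹-isSMor : IsSMor (σ (κ C)) C η⁻¹
    η⁻¹-isSMor = record
      { resp = λ { (_ , X , v , (xv , _) , χv≡a) (_ , Y , w , (yw , _) , χw≡a) (refl , (u , (xu , yu) , χu≡a)) →
                   ≈-trans (χ-inj (proj₁ X) v u xv xu (trans χv≡a (sym χu≡a)))
                           (χ-inj (proj₁ Y) u w yu yw (trans χu≡a (sym χw≡a))) }
      ; simp = η⁻¹-simp
      ; col  = λ { (_ , _ , _ , _ , χv≡a) → χv≡a }
      ; lab  = λ i fi j fj η⁻¹[i]⊆j p _ →
                 ⟺-trans (≐⇒⟺ (ℓ-ext j fj _ (proj₂ (proj₁ i)) (≐-sym (η⁻¹-facets⇒≐ i fi j η⁻¹[i]⊆j))) p)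
                         (⟺-sym (K.σ-ℓ⟺L i fi p))
      }

    η-pointed : ∀ X live-X → image C (σ (κ C)) η (mem (proj₁ X)) ⊆ SK.mem (XwIdx (κ C) X live-X)
    η-pointed X _ x (v , xv , ηv≈x) = refl , (v , (xv , η-≈⇒∈ x ηv≈x) , proj₁ ηv≈x)

    η⁻¹-pointed : ∀ X live-X → image (σ (κ C)) C η⁻¹ (SK.mem (XwIdx (κ C) X live-X)) ⊆ mem (proj₁ X)
    η⁻¹-pointed X _ u (x , (_ , X∼x) , η⁻¹x≈u) = mem-closed (proj₁ X) _ u (Xw⇒∈ X x X∼x) η⁻¹x≈u

    η∘η⁻¹≈id : ∀ x → η (η⁻¹ x) SK.≈ x
    η∘η⁻¹≈id (_ , _ , v , (xv , _) , χv≡a) = χv≡a , (v , (∈-facet-of v , xv) , refl)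

  η-natural : {C D : SData} (isC : IsSModel C) (isD : IsSModel D) {f : SData.V C → SData.V D}
              (isf : IsSMor C D f) →
              ∀ v → SData._≈_ (σ (κ D)) (Unit.η isD (f v))
                      (σfun (κ C) (κ D) (κfun C D f) (κ-OnMorphisms.κ-isEMor isD isf) (Unit.η isC v))
  η-natural isC isD {f} isf v =
    IsSMor.col isf v ,
    (f v , (∈-facet-of (f v) , image⊆image-facet (facet-ofᶜ v) (f v) (∈-image (∈-facet-ofᶜ v))) , refl)
    where
    open SModelProperties isD using (∈-facet-of)
    open SModelProperties isC using () renaming (facet-of to facet-ofᶜ; ∈-facet-of to ∈-facet-ofᶜ)
    open κ-OnMorphisms isD isf using (image⊆image-facet; ∈-image)

  module Counit (M : PEModel) where
    M₀ : EData
    M₀ = proj₁ M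

    open EData M₀
    open PEModelProperties (proj₁ (proj₂ M)) (proj₂ (proj₂ M))
    open SModelProperties σ-isSModel using (κ-isEModel; κ-proper)
    module K = PEModelProperties κ-isEModel κ-proper
    module SM = SData (σ M₀)

    ε : W → Pred (Facet (σ M₀))
    ε w Z = SM.mem (proj₁ Z) ≐ Xw M₀ w

    ε⁻¹ : Facet (σ M₀) → Pred W
    ε⁻¹ Z w = SM.mem (proj₁ Z) ≐ Xw M₀ w

    Xw-facet : W → Facet (σ M₀)
    Xw-facet w = XwIx M w , Xw-isFacet w (liveW M w)

    ε-Xw-facet : ∀ w → ε w (Xw-facet w)
    ε-Xw-facet w = (λ _ → proj₂) , (λ _ w∼x → refl , w∼x)

    ε⇒sat : ∀ u → ε u ⊆ sat (κ (σ M₀)) (live M₀ u) (Xw-facet u)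
    ε⇒sat u Z Z≐Xu a live-a = let x = a , u , live-a in x , ((refl , live-a) , proj₂ Z≐Xu x live-a) , refl

    sat⇒ε : ∀ u → sat (κ (σ M₀)) (live M₀ u) (Xw-facet u) ⊆ ε u
    sat⇒ε u Z Xu∼Z = (λ x zx → proj₂ (proj₂ (Xw-facet u) (proj₁ Z) (λ y → Xu⊆Z y ∘ proj₂) x zx)) , Xu⊆Z
      where
      Xu⊆Z : Xw M₀ u ⊆ SM.mem (proj₁ Z)
      Xu⊆Z y@(b , _ , _) u∼v with Xu∼Z b (∼⇒liveˡ u∼v)
      ... | x , ((_ , u∼w) , zx) , refl = σ-mem-closed (proj₁ Z) x y zx (refl , ∼-trans (∼-sym u∼w) u∼v)

    ε-isEMor : IsEMor M₀ (κ (σ M₀)) ε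
    ε-isEMor = record
      { resp = λ _ _ _ _ u≈u′ Z≐Z′ Z≐Xu → ≐-trans (≐-sym Z≐Z′) (≐-trans Z≐Xu (≈⇒Xw≐ u≈u′))
      ; rel  = λ a u _ u∼v _ _ Z≐Xu Z′≐Xv → let x = a , u , ∼⇒liveˡ u∼v in
                 x , (proj₂ Z≐Xu x (∼⇒liveˡ u∼v) , proj₂ Z′≐Xv x (∼-sym u∼v)) , refl
      ; gen  = λ u → Xw-facet u , ε-Xw-facet u , ε⇒sat u , sat⇒ε u
      ; lab  = λ _ Z Z≐Xu p _ → σ-ℓ⟺L-at (proj₁ Z) (proj₂ Z) Z≐Xu p
      }

    ε⁻¹⇒sat : ∀ Z → ε⁻¹ Z ⊆ sat M₀ (live (κ (σ M₀)) Z) (proj₁ (proj₁ Z))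
    ε⁻¹⇒sat (i , fi) w Z≐Xw a (x , (zx , _) , refl) =
      ≈⇒sat (Xw≐⇒≈ (≐-trans (≐-sym (facet-mem i fi)) Z≐Xw)) a (∼⇒liveˡ (proj₁ (facet-mem i fi) x zx))

    sat⇒ε⁻¹ : ∀ Z → sat M₀ (live (κ (σ M₀)) Z) (proj₁ (proj₁ Z)) ⊆ ε⁻¹ Z
    sat⇒ε⁻¹ Z@(i@(u , _) , fi) w Zu∼w = ≐-trans (facet-mem i fi) (≈⇒Xw≐ (sat⇒≈ λ a live-a →
      let x = a , u , live-a ; zx = proj₂ (facet-mem i fi) x live-a in Zu∼w a (x , (zx , zx) , refl)))

    ε⁻¹-isEMor : IsEMor (κ (σ M₀)) M₀ ε⁻¹
    ε⁻¹-isEMor = record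
      { resp = λ _ _ _ _ Z≐Z′ u≈u′ Z≐Xu → ≐-trans (≐-sym Z≐Z′) (≐-trans Z≐Xu (≈⇒Xw≐ u≈u′))
      ; rel  = λ { _ _ _ (x , (zx , z′x) , refl) _ _ Z≐Xu Z′≐Xv →
                   ∼-trans (proj₁ Z≐Xu x zx) (∼-sym (proj₁ Z′≐Xv x z′x)) }
      ; gen  = λ Z → proj₁ (proj₁ Z) , facet-mem (proj₁ Z) (proj₂ Z) , ε⁻¹⇒sat Z , sat⇒ε⁻¹ Z
      ; lab  = λ Z _ Z≐Xw p _ → ⟺-sym (σ-ℓ⟺L-at (proj₁ Z) (proj₂ Z) Z≐Xw p)
      }

    ε⁻¹∘ε≈id : EqE M₀ M₀ (compE M₀ (κ (σ M₀)) M₀ ε ε⁻¹) (idE M₀)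
    ε⁻¹∘ε≈id u x =
      (λ (_ , _ , Z≐Xu , Z≐Xw , w∼x) → ≈-sat⇒≈ (Xw≐⇒≈ (≐-trans (≐-sym Z≐Xu) Z≐Xw)) w∼x) ,
      (λ u≈x → Xw-facet u , u , ε-Xw-facet u , ε-Xw-facet u , ≈⇒sat u≈x)

    ε∘ε⁻¹≈id : EqE (κ (σ M₀)) (κ (σ M₀)) (compE (κ (σ M₀)) M₀ (κ (σ M₀)) ε⁻¹ ε) (idE (κ (σ M₀)))
    ε∘ε⁻¹≈id Z Z′ =
      (λ (_ , Z″ , Z≐Xw , Z″≐Xw , Z″∼Z′) → K.≈-sat⇒≈ {Z} {Z″} {Z′} (≐-trans Z≐Xw (≐-sym Z″≐Xw)) Z″∼Z′) ,
      (λ Z≈Z′ → proj₁ (proj₁ Z) , Z , facet-mem (proj₁ Z) (proj₂ Z) , facet-mem (proj₁ Z) (proj₂ Z) ,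
                K.≈⇒sat {Z} {Z′} Z≈Z′)

  module CounitNaturality (M N : PEModel) (h : EMor M N) where
    open σ-OnMorphisms M N h
    open EData N₀ using () renaming (_∼[_]_ to _∼ᴺ[_]_)
    module εM = Counit M
    module εN = Counit N

    sat-via-Xw : ∀ u (Z′ Z : Facet (σ N₀)) →
                 (∀ {a w} {l : live N₀ w a} → live M₀ u a → SN.mem (proj₁ Z′) (a , w , l) → g u ∼ᴺ[ a ] w) →
                 sat (κ (σ N₀)) (live M₀ u) Z′ Z → sat (κ (σ N₀)) (live M₀ u) (εN.Xw-facet (g u)) Z
    sat-via-Xw u Z′ Z gu∼Z′ Z′∼Z a live-a with Z′∼Z a live-a
    ... | x@(_ , _ , l) , (z′x , zx) , refl = x , ((refl , gu∼Z′ {l = l} live-a z′x) , zx) , refl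

    ε-natural : EqE M₀ (κ (σ N₀)) (compE M₀ (κ (σ M₀)) (κ (σ N₀)) εM.ε (κfun (σ M₀) (σ N₀) σh))
                                  (compE M₀ N₀ (κ (σ N₀)) (rel h) εN.ε)
    ε-natural u Z =
      (λ (Z₁ , Z₂ , Z₁≐Xu , σh[Z₁]⊆Z₂ , Z₂∼Z) →
         g u , εN.Xw-facet (g u) , h-g u , εN.ε-Xw-facet (g u) ,
         sat-via-Xw u Z₂ Z (λ {a} {w} {l} live-a z₂x →
           let x = a , u , live-a in
           proj₂ (IsSModel.χ-inj PN.σ-isSModel (proj₁ Z₂) (σh x) (a , w , l)
                   (σh[Z₁]⊆Z₂ (σh x) (x , proj₂ Z₁≐Xu x live-a , PN.σ-≈-refl {σh x})) z₂x refl))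
           Z₂∼Z) ,
      (λ (v , Z₂ , huv , Z₂≐Xv , Z₂∼Z) →
         εM.Xw-facet u , εN.Xw-facet (g u) , εM.ε-Xw-facet u , σh-pointed u (g u) (h-g u) ,
         sat-via-Xw u Z₂ Z (λ {a} {w} {l} live-a z₂x →
           PN.∼-trans (h⇒sat huv a live-a) (proj₁ Z₂≐Xv (a , w , l) z₂x))
           Z₂∼Z)

  well-defined : WellDefined
  well-defined = record
    { κ-obj    = λ C → SModelProperties.κ-isEModel (proj₂ C) , SModelProperties.κ-proper (proj₂ C)
    ; σ-obj    = λ M → PEModelProperties.σ-isSModel (proj₁ (proj₂ M)) (proj₂ (proj₂ M))
    ; κ-mor    = λ _ D f → κ-OnMorphisms.κ-isEMor (proj₂ D) (isMor f)
    ; σ-mor    = σ-OnMorphisms.σh-isSMor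
    ; σ-pt-obj = λ M w → PEModelProperties.Xw-isFacet (proj₁ (proj₂ M)) (proj₂ (proj₂ M)) w (liveW M w)
    ; σ-pt-mor = σ-OnMorphisms.σh-pointed
    }

  open Functors well-defined using (κO; σO)

  unit : ∀ C → SMor C (σO (κO C))
  unit C = smor (Unit.η (proj₂ C)) (Unit.η-isSMor (proj₂ C))

  unit⁻¹ : ∀ C → SMor (σO (κO C)) C
  unit⁻¹ C = smor (Unit.η⁻¹ (proj₂ C)) (Unit.η⁻¹-isSMor (proj₂ C))

  counit : ∀ M → EMor M (κO (σO M))
  counit M = emor (Counit.ε M) (Counit.ε-isEMor M)

  counit⁻¹ : ∀ M → EMor (κO (σO M)) M
  counit⁻¹ M = emor (Counit.ε⁻¹ M) (Counit.ε⁻¹-isEMor M)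

  equivalence : Equivalence well-defined
  equivalence = record
    { η      = unit
    ; η⁻¹    = unit⁻¹
    ; η-iso₁ = λ C _ → IsEquivalence.refl (IsSModel.≈-equiv (proj₂ C))
    ; η-iso₂ = λ C → Unit.η∘η⁻¹≈id (proj₂ C)
    ; η-nat  = λ C D f → η-natural (proj₂ C) (proj₂ D) (isMor f)
    ; ε      = counit
    ; ε⁻¹    = counit⁻¹
    ; ε-iso₁ = Counit.ε⁻¹∘ε≈id
    ; ε-iso₂ = Counit.ε∘ε⁻¹≈id
    ; ε-nat  = CounitNaturality.ε-natural
    }

  pointed-equivalence : PointedEquivalence well-defined
  pointed-equivalence = record
    { η      = λ C X → unit C , Unit.η-pointed (proj₂ C) X (liveW (κO C) X)
    ; η⁻¹    = λ C X → unit⁻¹ C , Unit.η⁻¹-pointed (proj₂ C) X (liveW (κO C) X)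
    ; η-iso₁ = λ C _ _ → IsEquivalence.refl (IsSModel.≈-equiv (proj₂ C))
    ; η-iso₂ = λ C _ → Unit.η∘η⁻¹≈id (proj₂ C)
    ; η-nat  = λ C _ D _ f _ → η-natural (proj₂ C) (proj₂ D) (isMor f)
    ; ε      = λ M w → counit M , Counit.ε-Xw-facet M w
    ; ε⁻¹    = λ M w → counit⁻¹ M , Counit.ε-Xw-facet M w
    ; ε-iso₁ = λ M _ → Counit.ε⁻¹∘ε≈id M
    ; ε-iso₂ = λ M _ → Counit.ε∘ε⁻¹≈id M
    ; ε-nat  = λ M _ N _ h _ → CounitNaturality.ε-natural M N h
    }

theorem29 : ExcludedMiddle (Level.suc 0ℓ) →
    (A : Set) (n : ℕ) → A ↔ Fin (suc n) →
    (AP : Set) (own : AP → A) →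
    Setup.Theorem29 A AP own
theorem29 em A _ A↔Fin AP own = record
  { wellDefined = well-defined
  ; equivalence = equivalence
  ; pointed     = pointed-equivalence
  }
  where open KappaSigma em A (↔⇒↣ A↔Fin) AP own
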